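{- Let $T$ be a regular set of patterns and $p\ge0$. If $\sigma,\tau\in\mathfrak{S}_n(T)$ and $d(\sigma,\tau)\le p$, then for every $s\ge1$, $d(r^s(\sigma^0),\ell^s(\tau^1))\le p$.
   Context: $\mathfrak{S}_n(T)$ is the set of permutations of $\{1,\ldots,n\}$ avoiding every pattern in $T$; $d(\sigma,\tau)$ is the number of positions in which two permutations of the same length differ (directions ignored). The sites of $\pi\in\mathfrak{S}_n$ are the $n+1$ gaps between consecutive entries, before the first and after the last entry, numbered from right to left $1,\ldots,n+1$. For $\pi\in\mathfrak{S}_n(T)$, site $i$ is active if inserting $n+1$ into site $i$ gives a permutation in $\mathfrak{S}_{n+1}(T)$. $T$ is regular if for every $n\ge1$ and every $\pi\in\mathfrak{S}_n(T)$: $\pi$ has at least two active sites and they are right justified (so the active sites are $1,\ldots,k$); and the number of active sites of the permutation obtained by inserting $n+1$ into the $i$-th active site of $\pi$ depends only on $i$ and the number $k$ of active sites of $\pi$. A directed permutation is a pair $\pi^i$ of a permutation $\pi$ and a direction $i\in\{0,1\}$ ($1$ = up, $0$ = down). For $k\ge2$, let $L_k$ be $1,3,5,\ldots,k,k-1,k-3,\ldots,4,2$ if $k$ is odd and $1,3,5,\ldots,k-1,k,k-2,\ldots,4,2$ if $k$ is even. For $\pi\in\mathfrak{S}_n(T)$ with $k$ active sites, $\phi(\pi^1)$ is the list of $k$ directed permutations whose $j$-th element is $\pi$ with $n+1$ inserted into its $L_k(j)$-th active site, the first having direction $1$ and all others direction $0$; $\phi(\pi^0)$ is the reversal of $\phi(\pi^1)$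 with every direction flipped. For a directed permutation $\pi^i$, $\ell(\pi^i)$ is the first element of $\phi(\pi^i)$ and $r(\pi^i)$ the last; $\ell^s$ and $r^s$ denote their $s$-fold iterates. -}

module Defs where

open import Data.Nat using (ℕ; zero; suc; _+_; _∸_; _≤_; _<ᵇ_; _≡ᵇ_; _%_)
open import Data.Bool using (Bool; true; false; not; _∧_; _∨_; if_then_else_)
open import Data.List using (List; []; _∷_; _++_; map; length; take; drop; upTo; filterᵇ; reverse; head; last)
open import Data.Bool.ListAction using (any; all)
open import Data.Maybe using (fromMaybe)
open import Data.Product using (_×_; _,_; proj₁; proj₂; Σ)
open import Data.List.Relation.Binary.Permutation.Propositional using (_↭_)
open import Relation.Binary.PropositionalEquality using (_≡_)

Perm : Set
Perm = List ℕ

IsPerm : ℕ → Perm → Set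
IsPerm n π = π ↭ map suc (upTo n)

_==_ : Bool → Bool → Bool
true  == b = b
false == b = not b

subseqs : List ℕ → List (List ℕ)
subseqs []       = [] ∷ []
subseqs (x ∷ xs) = map (x ∷_) (subseqs xs) ++ subseqs xs

headCompat : ℕ → ℕ → List ℕ → List ℕ → Bool
headCompat x y []        []        = true
headCompat x y (a ∷ as) (b ∷ bs) =
  ((x <ᵇ a) == (y <ᵇ b)) ∧ ((a <ᵇ x) == (b <ᵇ y)) ∧ headCompat x y as bs
headCompat x y _ _ = false

orderIso : List ℕ → List ℕ → Bool
orderIso []       []       = true
orderIso (x ∷ xs) (y ∷ ys) = headCompat x y xs ys ∧ orderIso xs ys
orderIso _        _        = false

contains : Perm → Perm → Bool
contains π τ = any (λ s → orderIso s τ) (subseqs π)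

avoids : List Perm → Perm → Bool
avoids Tp π = all (λ τ → not (contains π τ)) Tp

InS : List Perm → ℕ → Perm → Set
InS Tp n π = IsPerm n π × avoids Tp π ≡ true

dist : List ℕ → List ℕ → ℕ
dist (x ∷ xs) (y ∷ ys) = (if x ≡ᵇ y then 0 else 1) + dist xs ys
dist _ _ = 0

-- Sites of π (length n) are numbered 1,…,n+1 from right to left;
-- site i has exactly i-1 entries to its right.
sites : Perm → List ℕ
sites π = map suc (upTo (suc (length π)))

ins : Perm → ℕ → Perm
ins π i = take (length π ∸ (i ∸ 1)) π ++ suc (length π) ∷ drop (length π ∸ (i ∸ 1)) π

activeSites : List Perm → Perm → List ℕ
activeSites Tp π = filterᵇ (λ i → avoids Tp (ins π i)) (sites π)

numActive : List Perm → Perm → ℕ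
numActive Tp π = length (activeSites Tp π)

-- 1-indexed lookup (default 0)
nth : List ℕ → ℕ → ℕ
nth []       _             = 0
nth (x ∷ xs) zero          = 0
nth (x ∷ xs) (suc zero)    = x
nth (x ∷ xs) (suc (suc i)) = nth xs (suc i)

activeSite : List Perm → Perm → ℕ → ℕ
activeSite Tp π i = nth (activeSites Tp π) i

Regular : List Perm → Set
Regular Tp =
  (∀ n → 1 ≤ n → ∀ π → InS Tp n π →
     2 ≤ numActive Tp π × activeSites Tp π ≡ map suc (upTo (numActive Tp π)))
  × Σ (ℕ → ℕ → ℕ) (λ f → ∀ n → 1 ≤ n → ∀ π → InS Tp n π → ∀ i → 1 ≤ i → i ≤ numActive Tp π →
       numActive Tp (ins π (activeSite Tp π i)) ≡ f i (numActive Tp π))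

isOdd : ℕ → Bool
isOdd m = m % 2 ≡ᵇ 1

Lseq : ℕ → List ℕ
Lseq k = filterᵇ isOdd (map suc (upTo k)) ++ reverse (filterᵇ (λ m → not (isOdd m)) (map suc (upTo k)))

-- directed permutations: direction true = 1 = up, false = 0 = down
DPerm : Set
DPerm = Perm × Bool

phiUp : List Perm → Perm → List DPerm
phiUp Tp π with Lseq (numActive Tp π)
... | []       = []
... | a ∷ rest = (ins π (activeSite Tp π a) , true) ∷ map (λ b → (ins π (activeSite Tp π b) , false)) rest

flipDir : DPerm → DPerm
flipDir (π , b) = (π , not b)

phi : List Perm → DPerm → List DPerm
phi Tp (π , true)  = phiUp Tp π
phi Tp (π , false) = reverse (map flipDir (phiUp Tp π))

-- ℓ and r: first and last element of φ (default: the input, never used under regularity)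
ell : List Perm → DPerm → DPerm
ell Tp d = fromMaybe d (head (phi Tp d))

rr : List Perm → DPerm → DPerm
rr Tp d = fromMaybe d (last (phi Tp d))

iter : ℕ → (DPerm → DPerm) → DPerm → DPerm
iter zero    f x = x
iter (suc s) f x = f (iter s f x)

-- Under regularity site 1 is always active, and L_k starts with 1, so ℓ(π¹) is π with n+1
-- appended at the end, pointing up.  Since φ(π⁰) is φ(π¹) reversed with directions flipped,
-- r(π⁰) is the same permutation pointing down.  Hence rˢ(σ⁰) and ℓˢ(τ¹) are σ and τ with the
-- common suffix n+1, …, n+s appended, and appending a common suffix leaves the distance
-- unchanged (so the bound even holds with equality).
module Submission where

open import Defs
open import Data.Nat using (ℕ; zero; suc; _+_; _≤_; _≡ᵇ_; s≤s; z≤n)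
open import Data.Nat.GeneralisedArithmetic using (fold)
open import Data.Nat.Properties using (≤-refl; ≤-reflexive; ≤-trans; m≤n+m; suc-injective; ≡⇒≡ᵇ)
open import Data.Bool using (true; false; if_then_else_)
open import Data.Bool.Properties using (T-≡)
open import Data.Product using (∃; _,_; proj₁; proj₂)
open import Data.List using (List; []; _∷_; _++_; _∷ʳ_; map; upTo; applyUpTo; length; reverse; last)
open import Data.List.Properties
  using (unfold-reverse; map-++; upTo-∷ʳ; applyUpTo-∷ʳ; ++-assoc; ++-identityʳ; length-map; length-upTo; take-all; drop-all)
open import Data.List.Membership.Propositional using (_∈_)
open import Data.List.Membership.Propositional.Properties using (∈-filter⁻)
open import Data.List.Relation.Unary.All using (All)
open import Data.List.Relation.Unary.Any using (here)
open import Data.List.Relation.Binary.Permutation.Propositional using (_↭_)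
open import Data.List.Relation.Binary.Permutation.Propositional.Properties using (↭-length; ↭-empty-inv; ++⁺ʳ)
open import Data.Maybe using (just; fromMaybe)
open import Function using (Equivalence)
open import Relation.Nullary.Decidable using (T?)
open import Relation.Binary.PropositionalEquality using (_≡_; refl; sym; trans; cong; subst; module ≡-Reasoning)
open ≡-Reasoning

firstChild : List Perm → Perm → Perm
firstChild Tp π = proj₁ (ell Tp (π , true))

ell-up : ∀ Tp π → ell Tp (π , true) ≡ (firstChild Tp π , true)
ell-up Tp π with Lseq (numActive Tp π)
... | []    = refl
... | _ ∷ _ = refl

last-∷ʳ : ∀ {A : Set} (xs : List A) x → last (xs ∷ʳ x) ≡ just x
last-∷ʳ []           x = refl
last-∷ʳ (_ ∷ [])     x = refl
last-∷ʳ (_ ∷ y ∷ ys) x = last-∷ʳ (y ∷ ys) x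

rr-down : ∀ Tp π → rr Tp (π , false) ≡ (firstChild Tp π , false)
rr-down Tp π with Lseq (numActive Tp π)
... | []         = refl
... | a ∷ others = cong (fromMaybe (π , false))
  (trans (cong last (unfold-reverse (child a) rest)) (last-∷ʳ (reverse rest) (child a)))
  where
  child : ℕ → DPerm
  child b = (ins π (activeSite Tp π b) , false)
  rest : List DPerm
  rest = map flipDir (map child others)

iterate-lift : ∀ (f : DPerm → DPerm) (g : Perm → Perm) d →
  (∀ π → f (π , d) ≡ (g π , d)) → ∀ s π → iter s f (π , d) ≡ (fold π g s , d)
iterate-lift f g d f≡g zero    π = refl
iterate-lift f g d f≡g (suc s) π = trans (cong f (iterate-lift f g d f≡g s π)) (f≡g _)

Lseq-head : ∀ {k} → 1 ≤ k → ∃ λ rest → Lseq k ≡ 1 ∷ rest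
Lseq-head (s≤s _) = _ , refl

firstChild-≡ : ∀ Tp π → 1 ≤ numActive Tp π → firstChild Tp π ≡ ins π (activeSite Tp π 1)
firstChild-≡ Tp π 1≤k with Lseq (numActive Tp π) | Lseq-head 1≤k
... | _ | _ , refl = refl

ins-1 : ∀ π → ins π 1 ≡ π ∷ʳ suc (length π)
ins-1 π rewrite take-all (length π) π ≤-refl | drop-all (length π) π ≤-refl = refl

length-IsPerm : ∀ {n π} → IsPerm n π → length π ≡ n
length-IsPerm {n} π↭ = trans (↭-length π↭) (trans (length-map suc (upTo n)) (length-upTo n))

IsPerm-∷ʳ : ∀ {n π} → IsPerm n π → IsPerm (suc n) (π ∷ʳ suc n)
IsPerm-∷ʳ {n} {π} π↭ = subst (π ∷ʳ suc n ↭_) map-suc-upTo-∷ʳ (++⁺ʳ (suc n ∷ []) π↭)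
  where
  map-suc-upTo-∷ʳ : map suc (upTo n) ∷ʳ suc n ≡ map suc (upTo (suc n))
  map-suc-upTo-∷ʳ = trans (sym (map-++ suc (upTo n) (n ∷ []))) (cong (map suc) (upTo-∷ʳ n))

1∈map-suc-upTo : ∀ {k} → 1 ≤ k → 1 ∈ map suc (upTo k)
1∈map-suc-upTo (s≤s _) = here refl

nth-1-map-suc-upTo : ∀ {k} → 1 ≤ k → nth (map suc (upTo k)) 1 ≡ 1
nth-1-map-suc-upTo (s≤s _) = refl

module _ (Tp : List Perm) (regular : Regular Tp) {n : ℕ} (1≤n : 1 ≤ n) {π : Perm} (π∈ : InS Tp n π) where

  private
    2≤k : 2 ≤ numActive Tp π
    2≤k = proj₁ (proj₁ regular n 1≤n π π∈)

    1≤k : 1 ≤ numActive Tp π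
    1≤k = ≤-trans (s≤s z≤n) 2≤k

    sites≡ : activeSites Tp π ≡ map suc (upTo (numActive Tp π))
    sites≡ = proj₂ (proj₁ regular n 1≤n π π∈)

    ins-1≡∷ʳ : ins π 1 ≡ π ∷ʳ suc n
    ins-1≡∷ʳ = trans (ins-1 π) (cong (λ m → π ∷ʳ suc m) (length-IsPerm (proj₁ π∈)))

  firstChild-regular : firstChild Tp π ≡ π ∷ʳ suc n
  firstChild-regular = begin
    firstChild Tp π            ≡⟨ firstChild-≡ Tp π 1≤k ⟩
    ins π (activeSite Tp π 1)  ≡⟨ cong (λ sites → ins π (nth sites 1)) sites≡ ⟩
    ins π (nth (map suc (upTo (numActive Tp π))) 1)
                               ≡⟨ cong (ins π) (nth-1-map-suc-upTo 1≤k) ⟩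
    ins π 1                    ≡⟨ ins-1≡∷ʳ ⟩
    π ∷ʳ suc n                 ∎

  ∷ʳ-InS : InS Tp (suc n) (π ∷ʳ suc n)
  ∷ʳ-InS = IsPerm-∷ʳ (proj₁ π∈) , subst (λ π′ → avoids Tp π′ ≡ true) ins-1≡∷ʳ site-1-active
    where
    1∈active : 1 ∈ activeSites Tp π
    1∈active = subst (1 ∈_) (sym sites≡) (1∈map-suc-upTo 1≤k)
    site-1-active : avoids Tp (ins π 1) ≡ true
    site-1-active = Equivalence.to T-≡ (proj₂ (∈-filter⁻ (λ i → T? (avoids Tp (ins π i))) 1∈active))

appendRun : ℕ → ℕ → List ℕ
appendRun n s = applyUpTo (λ i → suc (i + n)) s

++-appendRun-∷ʳ : ∀ (π : Perm) n s → (π ++ appendRun n s) ∷ʳ suc (s + n) ≡ π ++ appendRun n (suc s)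
++-appendRun-∷ʳ π n s = trans (++-assoc π (appendRun n s) _) (cong (π ++_) (applyUpTo-∷ʳ _ s))

module _ (Tp : List Perm) (regular : Regular Tp) {n : ℕ} (1≤n : 1 ≤ n) {π : Perm} (π∈ : InS Tp n π) where

  private
    1≤s+n : ∀ s → 1 ≤ s + n
    1≤s+n s = ≤-trans 1≤n (m≤n+m n s)

  ++-appendRun-InS : ∀ s → InS Tp (s + n) (π ++ appendRun n s)
  ++-appendRun-InS zero    = subst (InS Tp n) (sym (++-identityʳ π)) π∈
  ++-appendRun-InS (suc s) = subst (InS Tp (suc s + n)) (++-appendRun-∷ʳ π n s)
                                   (∷ʳ-InS Tp regular (1≤s+n s) (++-appendRun-InS s))

  fold-firstChild : ∀ s → fold π (firstChild Tp) s ≡ π ++ appendRun n s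
  fold-firstChild zero    = sym (++-identityʳ π)
  fold-firstChild (suc s) = begin
    firstChild Tp (fold π (firstChild Tp) s)  ≡⟨ cong (firstChild Tp) (fold-firstChild s) ⟩
    firstChild Tp (π ++ appendRun n s)        ≡⟨ firstChild-regular Tp regular (1≤s+n s) (++-appendRun-InS s) ⟩
    (π ++ appendRun n s) ∷ʳ suc (s + n)       ≡⟨ ++-appendRun-∷ʳ π n s ⟩
    π ++ appendRun n (suc s)                  ∎

dist-refl : ∀ xs → dist xs xs ≡ 0
dist-refl []       = refl
dist-refl (x ∷ xs) rewrite Equivalence.to T-≡ (≡⇒≡ᵇ x x refl) = dist-refl xs

dist-++ʳ : ∀ xs ys zs → length xs ≡ length ys → dist (xs ++ zs) (ys ++ zs) ≡ dist xs ys
dist-++ʳ []       []       zs _  = dist-refl zs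
dist-++ʳ (x ∷ xs) (y ∷ ys) zs eq = cong ((if x ≡ᵇ y then 0 else 1) +_) (dist-++ʳ xs ys zs (suc-injective eq))

dist-fold-firstChild : ∀ Tp → Regular Tp → ∀ {n σ τ} → InS Tp n σ → InS Tp n τ →
  ∀ s → dist (fold σ (firstChild Tp) s) (fold τ (firstChild Tp) s) ≡ dist σ τ
dist-fold-firstChild Tp regular {zero} (σ↭ , _) (τ↭ , _) s
  rewrite ↭-empty-inv σ↭ | ↭-empty-inv τ↭ = dist-refl (fold [] (firstChild Tp) s)
dist-fold-firstChild Tp regular {suc n} {σ} {τ} σ∈ τ∈ s
  rewrite fold-firstChild Tp regular (s≤s z≤n) σ∈ s | fold-firstChild Tp regular (s≤s z≤n) τ∈ s =
  dist-++ʳ σ τ (appendRun (suc n) s) (trans (length-IsPerm (proj₁ σ∈)) (sym (length-IsPerm (proj₁ τ∈))))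

lemma4p4 : (Tp : List Perm) → All (λ t → IsPerm (length t) t) Tp → Regular Tp →
    (p n : ℕ) (σ τ : Perm) → InS Tp n σ → InS Tp n τ → dist σ τ ≤ p →
    (s : ℕ) → 1 ≤ s →
    dist (proj₁ (iter s (rr Tp) (σ , false))) (proj₁ (iter s (ell Tp) (τ , true))) ≤ p
lemma4p4 Tp _ regular p n σ τ σ∈ τ∈ d≤p s _
  rewrite iterate-lift (rr Tp) (firstChild Tp) false (rr-down Tp) s σ
        | iterate-lift (ell Tp) (firstChild Tp) true (ell-up Tp) s τ =
  ≤-trans (≤-reflexive (dist-fold-firstChild Tp regular σ∈ τ∈ s)) d≤p
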